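{- Let $L$ be a nonempty set, let $\mathcal C$ be the set of consequence operators on $L$, and let $C,C_1\in\mathcal C$ with $I<C<C_1$. Then an operator $C'\in\mathcal C$ is a complement of $C$ relative to $C_1$ with respect to $\vee$ (that is, $C\vee C'=C_1$ and $C\wedge C'=I$) if and only if $C'(A)=(C_1(A)\setminus C(A))\cup A$ for every $A\subseteq L$.
   Context: A consequence operator on a nonempty set $L$ is a map $C\colon\mathcal P(L)\to\mathcal P(L)$ such that for all $X,Y\subseteq L$: $X\subseteq C(X)=C(C(X))\subseteq L$, and $X\subseteq Y$ implies $C(X)\subseteq C(Y)$. $C_1\le C_2$ iff $C_1(X)\subseteq C_2(X)$ for all $X$; $<$ means $\le$ and $\ne$. $I$ is the identity on $\mathcal P(L)$. $(C_1\wedge C_2)(X)=C_1(X)\cap C_2(X)$ and $(C_1\vee C_2)(X)=C_1(X)\cup C_2(X)$. -}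

module Defs where

open import Level using (Level)
open import Data.Bool using (Bool; true; false; _∧_; _∨_; not)
open import Data.Product using (_×_)
open import Relation.Binary.PropositionalEquality using (_≡_)
open import Relation.Nullary using (¬_)

-- Subsets of L are represented by characteristic functions L → Bool
-- (P(L) ≅ 2^L), so membership is decidable, as in classical set theory.
Subset : ∀ {ℓ} → Set ℓ → Set ℓ
Subset L = L → Bool

module _ {ℓ : Level} {L : Set ℓ} where

  _⊆_ : Subset L → Subset L → Set ℓ
  X ⊆ Y = ∀ x → X x ≡ true → Y x ≡ true

  _≐_ : Subset L → Subset L → Set ℓ
  X ≐ Y = ∀ x → X x ≡ Y x

  _∪_ : Subset L → Subset L → Subset L
  (X ∪ Y) x = X x ∨ Y x

  _∩_ : Subset L → Subset L → Subset L
  (X ∩ Y) x = X x ∧ Y x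

  _∖_ : Subset L → Subset L → Subset L
  (X ∖ Y) x = X x ∧ not (Y x)

  Operator : Set ℓ
  Operator = Subset L → Subset L

  record IsConsequence (C : Operator) : Set ℓ where
    field
      inflationary : ∀ X → X ⊆ C X
      idempotent   : ∀ X → C (C X) ≐ C X
      monotone     : ∀ X Y → X ⊆ Y → C X ⊆ C Y

  I : Operator
  I X = X

  _≤_ : Operator → Operator → Set ℓ
  C₁ ≤ C₂ = ∀ X → C₁ X ⊆ C₂ X

  _≗_ : Operator → Operator → Set ℓ
  C₁ ≗ C₂ = ∀ X → C₁ X ≐ C₂ X

  _<_ : Operator → Operator → Set ℓ
  C₁ < C₂ = C₁ ≤ C₂ × ¬ (C₁ ≗ C₂)

  _⋀_ : Operator → Operator → Operator
  (C₁ ⋀ C₂) X = C₁ X ∩ C₂ X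

  _⋁_ : Operator → Operator → Operator
  (C₁ ⋁ C₂) X = C₁ X ∪ C₂ X

  IsRelComplement : Operator → Operator → Operator → Set ℓ
  IsRelComplement C C₁ C' = ((C ⋁ C') ≗ C₁) × ((C ⋀ C') ≗ I)

-- Everything happens pointwise in the Boolean algebra 2.  If c ∨ c' = c₁ and
-- c ∧ c' = a, then c' = ((c ∨ c') ∧ ¬c) ∨ (c ∧ c') = (c₁ ∧ ¬c) ∨ a, so a relative
-- complement is forced to be A ↦ (C₁ A ∖ C A) ∪ A.  Conversely, for a ≤ c ≤ c₁
-- this candidate does satisfy both equations.
module Submission where

open import Defs
open import Level using (Level)
open import Data.Bool using (true; false; _∧_; _∨_; not)
open import Data.Product using (_,_)
open import Function.Bundles using (_⇔_; mk⇔)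
open import Relation.Binary.PropositionalEquality
  using (_≡_; refl; sym; cong₂; module ≡-Reasoning)

split-by : ∀ c c' → c' ≡ ((c ∨ c') ∧ not c) ∨ (c ∧ c')
split-by false false = refl
split-by false true  = refl
split-by true  false = refl
split-by true  true  = refl

∨-relDiff : ∀ {a c c₁} → (a ≡ true → c ≡ true) → (c ≡ true → c₁ ≡ true) →
            c ∨ ((c₁ ∧ not c) ∨ a) ≡ c₁
∨-relDiff {false} {true}  {true}  _   _    = refl
∨-relDiff {true}  {true}  {true}  _   _    = refl
∨-relDiff {_}     {true}  {false} _   c≤c₁ with () ← c≤c₁ refl
∨-relDiff {true}  {false} {_}     a≤c _    with () ← a≤c refl
∨-relDiff {false} {false} {false} _   _    = refl
∨-relDiff {false} {false} {true}  _   _    = refl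

∧-relDiff : ∀ {a c c₁} → (a ≡ true → c ≡ true) → c ∧ ((c₁ ∧ not c) ∨ a) ≡ a
∧-relDiff {a}     {true}  {false} _   = refl
∧-relDiff {false} {true}  {true}  _   = refl
∧-relDiff {true}  {true}  {true}  _   = refl
∧-relDiff {true}  {false} {_}     a≤c with () ← a≤c refl
∧-relDiff {false} {false} {_}     _   = refl

module _ {ℓ : Level} {L : Set ℓ} where

  relDiff : Operator {L = L} → Operator → Operator
  relDiff C C₁ A = (C₁ A ∖ C A) ∪ A

  relComplement⇒≗relDiff : ∀ {C C₁ C'} → IsRelComplement C C₁ C' → C' ≗ relDiff C C₁
  relComplement⇒≗relDiff {C} {C₁} {C'} (join , meet) A x = begin
    C' A x                                         ≡⟨ split-by (C A x) (C' A x) ⟩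
    ((C A x ∨ C' A x) ∧ not (C A x)) ∨ (C A x ∧ C' A x)
      ≡⟨ cong₂ (λ u v → (u ∧ not (C A x)) ∨ v) (join A x) (meet A x) ⟩
    relDiff C C₁ A x                               ∎
    where open ≡-Reasoning

  ≗relDiff⇒relComplement : ∀ {C C₁ C'} → I ≤ C → C ≤ C₁ →
                            C' ≗ relDiff C C₁ → IsRelComplement C C₁ C'
  ≗relDiff⇒relComplement {C} {C₁} {C'} I≤C C≤C₁ C'≗ = join , meet
    where
    join : (C ⋁ C') ≗ C₁
    join A x = begin
      C A x ∨ C' A x            ≡⟨ cong₂ _∨_ refl (C'≗ A x) ⟩
      C A x ∨ relDiff C C₁ A x  ≡⟨ ∨-relDiff (I≤C A x) (C≤C₁ A x) ⟩
      C₁ A x                    ∎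
      where open ≡-Reasoning

    meet : (C ⋀ C') ≗ I
    meet A x = begin
      C A x ∧ C' A x            ≡⟨ cong₂ _∧_ refl (C'≗ A x) ⟩
      C A x ∧ relDiff C C₁ A x  ≡⟨ ∧-relDiff (I≤C A x) ⟩
      A x                       ∎
      where open ≡-Reasoning

theorem3p3 : {ℓ : Level} (L : Set ℓ) → L → (C C₁ : Operator {L = L}) →
    IsConsequence C → IsConsequence C₁ → I < C → C < C₁ →
    (C' : Operator {L = L}) → IsConsequence C' →
    IsRelComplement C C₁ C' ⇔ (∀ A → C' A ≐ ((C₁ A ∖ C A) ∪ A))
theorem3p3 L _ C C₁ _ _ (I≤C , _) (C≤C₁ , _) C' _ =
  mk⇔ relComplement⇒≗relDiff (≗relDiff⇒relComplement I≤C C≤C₁)
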